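{- Let $\mathbf{L}=(\mathbf{A},G,H,F,P)$ be a tense DLI$^{+}$-algebra with $G(0)=0=H(0)$. Then the map $f:\mathsf{Con}(\mathbf{L})\to\mathsf{Con}(\mathrm{K}(\mathbf{L}))$ defined by $f(\theta)=\gamma_\theta$, where $(a,b)\,\gamma_\theta\,(x,y)$ iff $(a,x)\in\theta$ and $(b,y)\in\theta$, is an order isomorphism.
   Context: A DLI$^{+}$-algebra is $\langle A,\wedge,\vee,\to,0,1\rangle$ with bounded distributive lattice reduct such that $(a\to b)\wedge(a\to d)=a\to(b\wedge d)$, $(a\to d)\wedge(b\to d)=(a\vee b)\to d$, $0\to a=1$, $a\to 1=1$, $a\wedge(a\to b)\le b$. A tense DLI$^{+}$-algebra is $(\mathbf{A},G,H,F,P)$ with unary operations satisfying: $P(x)\le y$ iff $x\le G(y)$; $F(x)\le y$ iff $x\le H(y)$; $G(x)\wedge F(y)\le F(x\wedge y)$, $H(x)\wedge P(y)\le P(x\wedge y)$; $G(x\vee y)\le G(x)\vee F(y)$, $H(x\vee y)\le H(x)\vee P(y)$; $G(x\to y)\le G(x)\to G(y)$, $H(x\to y)\le H(x)\to H(y)$; $G(x\to y)\le F(x)\to F(y)$, $H(x\to y)\le P(x)\to P(y)$. $\mathsf{Con}(\mathbf{L})$ is the lattice of congruences of $\mathbf{L}$ (compatible with $\wedge,\vee,\to,0,1,G,H,F,P$). $\mathrm{K}(\mathbf{L})$ is the algebra on $K(A)=\{(a,b)\in A^2:a\wedge b=0\}$ with $(a,b)\vee(x,y)=(a\vee x,b\wedge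 y)$, $(a,b)\wedge(x,y)=(a\wedge x,b\vee y)$, $(a,b)\Rightarrow(x,y)=((a\to x)\wedge(y\to b),a\wedge y)$, $\sim(a,b)=(b,a)$, $0=(0,1)$, $1=(1,0)$, $c=(0,0)$, $G_K(a,b)=(G(a),F(b))$, $H_K(a,b)=(H(a),P(b))$; $\mathsf{Con}(\mathrm{K}(\mathbf{L}))$ is its lattice of congruences with respect to all these operations. Both are ordered by inclusion. -}

module Defs where

open import Level using (Level; suc)
open import Data.Product using (_×_; _,_; proj₁; proj₂)
open import Relation.Binary using (Rel; IsEquivalence)
open import Relation.Binary.PropositionalEquality
  using (_≡_; refl; sym; trans; cong; cong₂; module ≡-Reasoning)
import Algebra.Lattice.Structures as LS


record TenseDLI (ℓ : Level) : Set (suc ℓ) where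
  infixr 7 _∧_
  infixr 6 _∨_
  infixr 5 _⟶_
  infix 4 _≤_
  field
    Carrier : Set ℓ
    _∧_ _∨_ _⟶_ : Carrier → Carrier → Carrier
    𝟘 𝟙 : Carrier

  _≤_ : Carrier → Carrier → Set ℓ
  x ≤ y = x ∧ y ≡ x

  field
    isDistributiveLattice : LS.IsDistributiveLattice _≡_ _∨_ _∧_
    𝟘-least    : ∀ x → 𝟘 ≤ x
    𝟙-greatest : ∀ x → x ≤ 𝟙
    ⟶-∧ : ∀ a b d → (a ⟶ b) ∧ (a ⟶ d) ≡ a ⟶ (b ∧ d)
    ⟶-∨ : ∀ a b d → (a ⟶ d) ∧ (b ⟶ d) ≡ (a ∨ b) ⟶ d
    𝟘-⟶ : ∀ a → 𝟘 ⟶ a ≡ 𝟙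
    ⟶-𝟙 : ∀ a → a ⟶ 𝟙 ≡ 𝟙
    mp  : ∀ a b → a ∧ (a ⟶ b) ≤ b
    G H F P : Carrier → Carrier
    P⊣G : ∀ x y → (P x ≤ y → x ≤ G y) × (x ≤ G y → P x ≤ y)
    F⊣H : ∀ x y → (F x ≤ y → x ≤ H y) × (x ≤ H y → F x ≤ y)
    GF-∧ : ∀ x y → G x ∧ F y ≤ F (x ∧ y)
    HP-∧ : ∀ x y → H x ∧ P y ≤ P (x ∧ y)
    G-∨  : ∀ x y → G (x ∨ y) ≤ G x ∨ F y
    H-∨  : ∀ x y → H (x ∨ y) ≤ H x ∨ P y
    G-⟶  : ∀ x y → G (x ⟶ y) ≤ G x ⟶ G y
    H-⟶  : ∀ x y → H (x ⟶ y) ≤ H x ⟶ H y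
    GF-⟶ : ∀ x y → G (x ⟶ y) ≤ F x ⟶ F y
    HP-⟶ : ∀ x y → H (x ⟶ y) ≤ P x ⟶ P y

  open LS.IsDistributiveLattice isDistributiveLattice public
    using (∧-comm; ∧-assoc; ∨-comm; ∨-assoc; ∨-absorbs-∧; ∧-absorbs-∨;
           ∧-distribˡ-∨; ∧-distribʳ-∨)

module _ {ℓ : Level} (L : TenseDLI ℓ) where
  open TenseDLI L
  open ≡-Reasoning

  -- Congruences of L (compatible with ∧, ∨, ⟶, G, H, F, P;
  -- compatibility with the constants 0, 1 is automatic).

  record IsCon (θ : Rel Carrier ℓ) : Set ℓ where
    field
      isEquivalence : IsEquivalence θ
      ∧-compat : ∀ {a b c d} → θ a b → θ c d → θ (a ∧ c) (b ∧ d)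
      ∨-compat : ∀ {a b c d} → θ a b → θ c d → θ (a ∨ c) (b ∨ d)
      ⟶-compat : ∀ {a b c d} → θ a b → θ c d → θ (a ⟶ c) (b ⟶ d)
      G-compat : ∀ {a b} → θ a b → θ (G a) (G b)
      H-compat : ∀ {a b} → θ a b → θ (H a) (H b)
      F-compat : ∀ {a b} → θ a b → θ (F a) (F b)
      P-compat : ∀ {a b} → θ a b → θ (P a) (P b)

  ∧-idem : ∀ x → x ∧ x ≡ x
  ∧-idem x = trans (cong (x ∧_) (sym (∨-absorbs-∧ x x))) (∧-absorbs-∨ x (x ∧ x))

  ∧-𝟘 : ∀ x → x ∧ 𝟘 ≡ 𝟘
  ∧-𝟘 x = trans (∧-comm x 𝟘) (𝟘-least x)

  ≤𝟘 : ∀ {x} → x ≤ 𝟘 → x ≡ 𝟘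
  ≤𝟘 {x} p = trans (sym p) (∧-𝟘 x)

  ≡𝟘⇒≤ : ∀ {u} → u ≡ 𝟘 → u ≤ 𝟘
  ≡𝟘⇒≤ {u} e = trans (∧-𝟘 u) (sym e)

  ≤-trans : ∀ {x y z} → x ≤ y → y ≤ z → x ≤ z
  ≤-trans {x} {y} {z} p q = begin
    x ∧ z       ≡⟨ cong (_∧ z) (sym p) ⟩
    (x ∧ y) ∧ z ≡⟨ ∧-assoc x y z ⟩
    x ∧ (y ∧ z) ≡⟨ cong (x ∧_) q ⟩
    x ∧ y       ≡⟨ p ⟩
    x ∎

  ≤-glb : ∀ {x y z} → x ≤ y → x ≤ z → x ≤ y ∧ z
  ≤-glb {x} {y} {z} p q = begin
    x ∧ (y ∧ z) ≡⟨ sym (∧-assoc x y z) ⟩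
    (x ∧ y) ∧ z ≡⟨ cong (_∧ z) p ⟩
    x ∧ z       ≡⟨ q ⟩
    x ∎

  ∧≤ˡ : ∀ x y → x ∧ y ≤ x
  ∧≤ˡ x y = begin
    (x ∧ y) ∧ x ≡⟨ ∧-comm (x ∧ y) x ⟩
    x ∧ (x ∧ y) ≡⟨ sym (∧-assoc x x y) ⟩
    (x ∧ x) ∧ y ≡⟨ cong (_∧ y) (∧-idem x) ⟩
    x ∧ y ∎

  ∧≤ʳ : ∀ x y → x ∧ y ≤ y
  ∧≤ʳ x y = trans (∧-assoc x y y) (cong (x ∧_) (∧-idem y))

  ∧-mono : ∀ {x y u v} → x ≤ u → y ≤ v → x ∧ y ≤ u ∧ v
  ∧-mono p q = ≤-glb (≤-trans (∧≤ˡ _ _) p) (≤-trans (∧≤ʳ _ _) q)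

  disj-∨ : ∀ {a b x y} → a ∧ b ≡ 𝟘 → x ∧ y ≡ 𝟘 → (a ∨ x) ∧ (b ∧ y) ≡ 𝟘
  disj-∨ {a} {b} {x} {y} p q = begin
    (a ∨ x) ∧ (b ∧ y)             ≡⟨ ∧-distribʳ-∨ (b ∧ y) a x ⟩
    a ∧ (b ∧ y) ∨ x ∧ (b ∧ y)     ≡⟨ cong₂ _∨_ (≤𝟘 (≤-trans (∧-mono (≤-refl a) (∧≤ˡ b y)) (reflexive p)))
                                               (≤𝟘 (≤-trans (∧-mono (≤-refl x) (∧≤ʳ b y)) (reflexive q))) ⟩
    𝟘 ∨ 𝟘                         ≡⟨ ∨-idem 𝟘 ⟩
    𝟘 ∎
    where
    ≤-refl : ∀ z → z ≤ z
    ≤-refl = ∧-idem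
    reflexive : ∀ {u v} → u ≡ v → u ≤ v
    reflexive {u} refl = ∧-idem u
    ∨-idem : ∀ z → z ∨ z ≡ z
    ∨-idem z = trans (cong (z ∨_) (sym (∧-idem z))) (∨-absorbs-∧ z z)

  disj-∧ : ∀ {a b x y} → a ∧ b ≡ 𝟘 → x ∧ y ≡ 𝟘 → (a ∧ x) ∧ (b ∨ y) ≡ 𝟘
  disj-∧ {a} {b} {x} {y} p q =
    trans (∧-comm (a ∧ x) (b ∨ y))
      (trans (cong (_∧ (a ∧ x)) (∨-comm b y))
        (trans (cong ((y ∨ b) ∧_) (∧-comm a x))
          (disj-∨ {y} {x} {b} {a}
             (trans (∧-comm y x) q) (trans (∧-comm b a) p))))

  disj-⟶ : ∀ {a b x y} → a ∧ b ≡ 𝟘 → x ∧ y ≡ 𝟘 →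
           ((a ⟶ x) ∧ (y ⟶ b)) ∧ (a ∧ y) ≡ 𝟘
  disj-⟶ {a} {b} {x} {y} p q = ≤𝟘 (≤-trans (≤-glb t≤a t≤b) (trans (cong (_∧ 𝟘) p) (trans (∧-idem 𝟘) (sym p))))
    where
    t = ((a ⟶ x) ∧ (y ⟶ b)) ∧ (a ∧ y)
    t≤a : t ≤ a
    t≤a = ≤-trans (∧≤ʳ _ _) (∧≤ˡ a y)
    t≤b : t ≤ b
    t≤b = ≤-trans (≤-glb (≤-trans (∧≤ʳ _ _) (∧≤ʳ a y)) (≤-trans (∧≤ˡ _ _) (∧≤ʳ _ _)))
                  (mp y b)

  F𝟘 : F 𝟘 ≡ 𝟘
  F𝟘 = ≤𝟘 (proj₂ (F⊣H 𝟘 𝟘) (𝟘-least (H 𝟘)))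

  P𝟘 : P 𝟘 ≡ 𝟘
  P𝟘 = ≤𝟘 (proj₂ (P⊣G 𝟘 𝟘) (𝟘-least (G 𝟘)))

  disj-G : ∀ {a b} → a ∧ b ≡ 𝟘 → G a ∧ F b ≡ 𝟘
  disj-G {a} {b} p = ≤𝟘 (≤-trans (GF-∧ a b) (≡𝟘⇒≤ (trans (cong F p) F𝟘)))

  disj-H : ∀ {a b} → a ∧ b ≡ 𝟘 → H a ∧ P b ≡ 𝟘
  disj-H {a} {b} p = ≤𝟘 (≤-trans (HP-∧ a b) (≡𝟘⇒≤ (trans (cong P p) P𝟘)))

  record KA : Set ℓ where
    constructor ⟨_,_∣_⟩
    field
      fst snd : Carrier
      disj : fst ∧ snd ≡ 𝟘
  open KA public

  _∨K_ : KA → KA → KA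
  ⟨ a , b ∣ p ⟩ ∨K ⟨ x , y ∣ q ⟩ = ⟨ a ∨ x , b ∧ y ∣ disj-∨ p q ⟩

  _∧K_ : KA → KA → KA
  ⟨ a , b ∣ p ⟩ ∧K ⟨ x , y ∣ q ⟩ = ⟨ a ∧ x , b ∨ y ∣ disj-∧ p q ⟩

  _⇒K_ : KA → KA → KA
  ⟨ a , b ∣ p ⟩ ⇒K ⟨ x , y ∣ q ⟩ = ⟨ (a ⟶ x) ∧ (y ⟶ b) , a ∧ y ∣ disj-⟶ p q ⟩

  ∼K : KA → KA
  ∼K ⟨ a , b ∣ p ⟩ = ⟨ b , a ∣ trans (∧-comm b a) p ⟩

  0K : KA
  0K = ⟨ 𝟘 , 𝟙 ∣ 𝟘-least 𝟙 ⟩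

  1K : KA
  1K = ⟨ 𝟙 , 𝟘 ∣ ∧-𝟘 𝟙 ⟩

  cK : KA
  cK = ⟨ 𝟘 , 𝟘 ∣ ∧-idem 𝟘 ⟩

  GK : KA → KA
  GK ⟨ a , b ∣ p ⟩ = ⟨ G a , F b ∣ disj-G p ⟩

  HK : KA → KA
  HK ⟨ a , b ∣ p ⟩ = ⟨ H a , P b ∣ disj-H p ⟩

  -- Congruences of K(L) (compatible with ∨, ∧, ⇒, ∼, G_K, H_K;
  -- compatibility with the constants 0, 1, c is automatic).
  record IsConK (Φ : Rel KA ℓ) : Set ℓ where
    field
      isEquivalence : IsEquivalence Φ
      ∨-compat : ∀ {u v w z} → Φ u v → Φ w z → Φ (u ∨K w) (v ∨K z)
      ∧-compat : ∀ {u v w z} → Φ u v → Φ w z → Φ (u ∧K w) (v ∧K z)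
      ⇒-compat : ∀ {u v w z} → Φ u v → Φ w z → Φ (u ⇒K w) (v ⇒K z)
      ∼-compat : ∀ {u v} → Φ u v → Φ (∼K u) (∼K v)
      GK-compat : ∀ {u v} → Φ u v → Φ (GK u) (GK v)
      HK-compat : ∀ {u v} → Φ u v → Φ (HK u) (HK v)

  γ : Rel Carrier ℓ → Rel KA ℓ
  γ θ u v = θ (fst u) (fst v) × θ (snd u) (snd v)

-- A pair (a , b) of K(L) is recovered inside K(L) from its coordinates by
-- polynomials: (a , b) ∨ c = (a , 0), and ∼ (a , b) swaps the coordinates.
-- Hence a congruence Φ of K(L) is γ_θ for the relation θ that Φ induces on
-- the pairs (a , 0).  For the inclusion γ_θ ⊆ Φ, if a θ x and b θ y then Φ
-- relates (a , b) = (a , b) ∧ (a , 0) ∨ ∼ (b , 0) to (a , b) ∧ (x , 0) ∨ ∼ (y , 0),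
-- the pair (a ∧ x , b ∧ y), which is symmetric in (a , b) and (x , y).
module Submission where

open import Defs
open import Level using (Level)
open import Data.Product using (_×_; ∃; _,_; proj₁)
open import Relation.Binary using (Rel; _⇒_; IsEquivalence)
open import Relation.Binary.PropositionalEquality
  using (_≡_; refl; sym; trans; cong; subst₂)
open import Axiom.UniquenessOfIdentityProofs.WithK using (uip)

module _ {ℓ : Level} (L : TenseDLI ℓ) where
  open TenseDLI L

  private
    _∨ᴷ_ _∧ᴷ_ _⇒ᴷ_ : KA L → KA L → KA L
    _∨ᴷ_ = _∨K_ L
    _∧ᴷ_ = _∧K_ L
    _⇒ᴷ_ = _⇒K_ L

    ∼ᴷ : KA L → KA L
    ∼ᴷ = ∼K L

  ∨-identityʳ : ∀ x → x ∨ 𝟘 ≡ x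
  ∨-identityʳ x = trans (cong (x ∨_) (sym (∧-𝟘 L x))) (∨-absorbs-∧ x 𝟘)

  KA-≡ : ∀ {u v : KA L} → fst u ≡ fst v → snd u ≡ snd v → u ≡ v
  KA-≡ {⟨ a , b ∣ p ⟩} {⟨ .a , .b ∣ q ⟩} refl refl = cong ⟨ a , b ∣_⟩ (uip p q)

  ι : Carrier → KA L
  ι a = ⟨ a , 𝟘 ∣ ∧-𝟘 L a ⟩

  ∨K-c≡ι-fst : ∀ u → u ∨ᴷ cK L ≡ ι (fst u)
  ∨K-c≡ι-fst ⟨ a , b ∣ _ ⟩ = KA-≡ (∨-identityʳ a) (∧-𝟘 L b)

  fst-ι⇒ι : ∀ a c → fst (ι a ⇒ᴷ ι c) ≡ a ⟶ c
  fst-ι⇒ι a c = trans (cong ((a ⟶ c) ∧_) (𝟘-⟶ 𝟘)) (𝟙-greatest (a ⟶ c))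

  mix : KA L → KA L → KA L
  mix u v = (u ∧ᴷ ι (fst v)) ∨ᴷ ∼ᴷ (ι (snd v))

  fst-mix : ∀ u v → fst (mix u v) ≡ fst u ∧ fst v
  fst-mix ⟨ a , _ ∣ _ ⟩ ⟨ x , _ ∣ _ ⟩ = ∨-identityʳ (a ∧ x)

  snd-mix : ∀ u v → snd (mix u v) ≡ snd u ∧ snd v
  snd-mix ⟨ _ , b ∣ _ ⟩ ⟨ _ , y ∣ _ ⟩ = cong (_∧ y) (∨-identityʳ b)

  mix-comm : ∀ u v → mix u v ≡ mix v u
  mix-comm u v = KA-≡
    (trans (fst-mix u v) (trans (∧-comm (fst u) (fst v)) (sym (fst-mix v u))))
    (trans (snd-mix u v) (trans (∧-comm (snd u) (snd v)) (sym (snd-mix v u))))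

  mix-idem : ∀ u → mix u u ≡ u
  mix-idem u = KA-≡ (trans (fst-mix u u) (∧-idem L (fst u)))
                    (trans (snd-mix u u) (∧-idem L (snd u)))

  γ-isConK : ∀ {θ} → IsCon L θ → IsConK L (γ L θ)
  γ-isConK {θ} C = record
    { isEquivalence = record
        { refl  = Eq.refl , Eq.refl
        ; sym   = λ (p , q) → Eq.sym p , Eq.sym q
        ; trans = λ (p , q) (p′ , q′) → Eq.trans p p′ , Eq.trans q q′
        }
    ; ∨-compat  = λ { {⟨ _ , _ ∣ _ ⟩} {⟨ _ , _ ∣ _ ⟩} {⟨ _ , _ ∣ _ ⟩} {⟨ _ , _ ∣ _ ⟩} (p , q) (p′ , q′) →
                      C.∨-compat p p′ , C.∧-compat q q′ }
    ; ∧-compat  = λ { {⟨ _ , _ ∣ _ ⟩} {⟨ _ , _ ∣ _ ⟩} {⟨ _ , _ ∣ _ ⟩} {⟨ _ , _ ∣ _ ⟩} (p , q) (p′ , q′) →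
                      C.∧-compat p p′ , C.∨-compat q q′ }
    ; ⇒-compat  = λ { {⟨ _ , _ ∣ _ ⟩} {⟨ _ , _ ∣ _ ⟩} {⟨ _ , _ ∣ _ ⟩} {⟨ _ , _ ∣ _ ⟩} (p , q) (p′ , q′) →
                      C.∧-compat (C.⟶-compat p p′) (C.⟶-compat q′ q) , C.∧-compat p q′ }
    ; ∼-compat  = λ { {⟨ _ , _ ∣ _ ⟩} {⟨ _ , _ ∣ _ ⟩} (p , q) → q , p }
    ; GK-compat = λ { {⟨ _ , _ ∣ _ ⟩} {⟨ _ , _ ∣ _ ⟩} (p , q) → C.G-compat p , C.F-compat q }
    ; HK-compat = λ { {⟨ _ , _ ∣ _ ⟩} {⟨ _ , _ ∣ _ ⟩} (p , q) → C.H-compat p , C.P-compat q }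
    }
    where
    module C = IsCon C
    module Eq = IsEquivalence C.isEquivalence

  γ-mono : ∀ {θ θ′} → θ ⇒ θ′ → γ L θ ⇒ γ L θ′
  γ-mono θ⊆θ′ (p , q) = θ⊆θ′ p , θ⊆θ′ q

  γ-reflects-⊆ : ∀ {θ θ′} → IsCon L θ → γ L θ ⇒ γ L θ′ → θ ⇒ θ′
  γ-reflects-⊆ C γ⊆γ′ {a} {b} p =
    proj₁ (γ⊆γ′ {ι a} {ι b} (p , IsEquivalence.refl (IsCon.isEquivalence C)))

  module Induced {Φ : Rel (KA L) ℓ} (C : IsConK L Φ) where
    private
      module C = IsConK C
      module E = IsEquivalence C.isEquivalence

    θ : Rel Carrier ℓ
    θ a b = Φ (ι a) (ι b)

    fst-θ : Φ ⇒ λ u v → θ (fst u) (fst v)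
    fst-θ {u} {v} r =
      subst₂ Φ (∨K-c≡ι-fst u) (∨K-c≡ι-fst v) (C.∨-compat r (E.refl {cK L}))

    snd-θ : Φ ⇒ λ u v → θ (snd u) (snd v)
    snd-θ r = fst-θ (C.∼-compat r)

    Φ⊆γθ : Φ ⇒ γ L θ
    Φ⊆γθ r = fst-θ r , snd-θ r

    isCon : IsCon L θ
    isCon = record
      { isEquivalence = record { refl = E.refl ; sym = E.sym ; trans = E.trans }
      ; ∧-compat = λ r s → fst-θ (C.∧-compat r s)
      ; ∨-compat = λ r s → fst-θ (C.∨-compat r s)
      ; ⟶-compat = λ {a} {b} {c} {d} r s →
          subst₂ θ (fst-ι⇒ι a c) (fst-ι⇒ι b d) (fst-θ (C.⇒-compat r s))
      ; G-compat = λ r → fst-θ (C.GK-compat r)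
      ; H-compat = λ r → fst-θ (C.HK-compat r)
      ; F-compat = λ r → snd-θ (C.GK-compat (C.∼-compat r))
      ; P-compat = λ r → snd-θ (C.HK-compat (C.∼-compat r))
      }

    Φ-mix : ∀ {u v} → γ L θ u v → Φ u (mix u v)
    Φ-mix {u} (r , s) = subst₂ Φ (mix-idem u) refl
      (C.∨-compat (C.∧-compat (E.refl {u}) r) (C.∼-compat s))

    γθ⊆Φ : γ L θ ⇒ Φ
    γθ⊆Φ {u} {v} (r , s) = E.trans (Φ-mix {u} {v} (r , s))
      (subst₂ Φ (mix-comm v u) refl (E.sym (Φ-mix {v} {u} (E.sym r , E.sym s))))

-- The hypotheses G 0 = 0 = H 0 are not needed: the operations of K(L) are
-- well defined from F 0 = 0 = P 0 alone, which follow from the adjunctions.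
theorem7p2 : {ℓ : Level} (L : TenseDLI ℓ) →
    TenseDLI.G L (TenseDLI.𝟘 L) ≡ TenseDLI.𝟘 L →
    TenseDLI.H L (TenseDLI.𝟘 L) ≡ TenseDLI.𝟘 L →
    ((θ : Rel (TenseDLI.Carrier L) ℓ) → IsCon L θ → IsConK L (γ L θ))
    × ((θ θ′ : Rel (TenseDLI.Carrier L) ℓ) → IsCon L θ → IsCon L θ′ →
    (θ ⇒ θ′ → γ L θ ⇒ γ L θ′) × (γ L θ ⇒ γ L θ′ → θ ⇒ θ′))
    × ((Φ : Rel (KA L) ℓ) → IsConK L Φ →
    ∃ λ (θ : Rel (TenseDLI.Carrier L) ℓ) → IsCon L θ × (γ L θ ⇒ Φ) × (Φ ⇒ γ L θ))
theorem7p2 L _ _ =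
    (λ _ → γ-isConK L)
  , (λ _ _ C _ → γ-mono L , γ-reflects-⊆ L C)
  , λ _ C → let open Induced L C in θ , isCon , γθ⊆Φ , Φ⊆γθ
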